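{- (i) For positive integers $m\ge n$, the pair $(K_m,K_n)$ is competition-realizable if and only if one of the following holds: $n=1$; $m\ge n\ge 6$; $m\ge 10$ and $n=5$. (ii) For a positive integer $l$, the complete graph $K_l$ is $(1,2)$-step competition-realizable if and only if $l\ge 12$.
   Context: The competition graph $C(D)$ of a digraph $D$ is the graph on $V(D)$ in which distinct $u,v$ are adjacent iff they have a common out-neighbor in $D$. For graphs $G_1$ on $m$ vertices and $G_2$ on $n$ vertices, the pair $(G_1,G_2)$ is competition-realizable if the disjoint union of $G_1$ and $G_2$ is the competition graph of some orientation of the complete bipartite graph $K_{m,n}$ with bipartition $(V(G_1),V(G_2))$. For vertices $x,y$ of a digraph $H$, $d_H(x,y)$ is the length of a shortest directed $(x,y)$-path. The $(1,2)$-step competition graph $C_{1,2}(D)$ is the simple graph on $V(D)$ in which distinct $u,v$ are adjacent iff there is $w\neq u,v$ with either $d_{D-v}(u,w)\le 1$ and $d_{D-u}(v,w)\le 2$, or $d_{D-u}(v,w)\le 1$ and $d_{D-v}(u,w)\le 2$. A graph is $(1,2)$-step competition-realizable if it is isomorphic to $C_{1,2}(D)$ for some orientation $D$ of a complete bipartite graph $K_{m,n}$ with $m,n\ge1$. -}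

module Defs where

open import Data.Nat using (ℕ; zero; suc; _≤_)
open import Data.Fin using (Fin)
open import Data.Bool using (Bool; true; false)
open import Data.Sum using (_⊎_; inj₁; inj₂)
open import Data.Product using (Σ; ∃; _×_; _,_)
open import Data.Empty using (⊥)
open import Relation.Binary.PropositionalEquality using (_≡_; _≢_)
open import Function.Bundles using (_⇔_; _⤖_; Bijection)

Graph : Set → Set₁
Graph V = V → V → Set

Digraph : Set → Set₁
Digraph V = V → V → Set

K : (m : ℕ) → Graph (Fin m)
K m u v = u ≢ v

SameGraph : {V : Set} → Graph V → Graph V → Set
SameGraph {V} G H = (u v : V) → u ≢ v → (G u v ⇔ H u v)

Isomorphic : {V W : Set} → Graph V → Graph W → Set
Isomorphic {V} {W} G H =
  Σ (V ⤖ W) λ f → (u v : V) → u ≢ v →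
    (G u v ⇔ H (Bijection.to f u) (Bijection.to f v))

Union : {m n : ℕ} → Graph (Fin m) → Graph (Fin n) → Graph (Fin m ⊎ Fin n)
Union G₁ G₂ (inj₁ a) (inj₁ b) = G₁ a b
Union G₁ G₂ (inj₂ a) (inj₂ b) = G₂ a b
Union G₁ G₂ (inj₁ _) (inj₂ _) = ⊥
Union G₁ G₂ (inj₂ _) (inj₁ _) = ⊥

-- An orientation of K_{m,n} with bipartition (Fin m, Fin n):
-- o i j ≡ true means the arc i → j, false means j → i.
Orientation : ℕ → ℕ → Set
Orientation m n = Fin m → Fin n → Bool

Arc : {m n : ℕ} → Orientation m n → Digraph (Fin m ⊎ Fin n)
Arc o (inj₁ i) (inj₂ j) = o i j ≡ true
Arc o (inj₂ j) (inj₁ i) = o i j ≡ false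
Arc o (inj₁ _) (inj₁ _) = ⊥
Arc o (inj₂ _) (inj₂ _) = ⊥

Competition : {V : Set} → Digraph V → Graph V
Competition D u v = u ≢ v × ∃ λ w → D u w × D v w

-- Directed walks in D - z (avoiding the vertex z) from x to y of length k.
data WalkAvoid {V : Set} (D : Digraph V) (z : V) : V → V → ℕ → Set where
  here : ∀ {x} → x ≢ z → WalkAvoid D z x x 0
  step : ∀ {x y w k} → x ≢ z → D x y → WalkAvoid D z y w k →
         WalkAvoid D z x w (suc k)

DistLe : {V : Set} → Digraph V → (z x y : V) → ℕ → Set
DistLe D z x y k = ∃ λ j → j ≤ k × WalkAvoid D z x y j

Step12 : {V : Set} → Digraph V → Graph V
Step12 D u v = u ≢ v × ∃ λ w → w ≢ u × w ≢ v ×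
  ((DistLe D v u w 1 × DistLe D u v w 2) ⊎
   (DistLe D u v w 1 × DistLe D v u w 2))

CompRealizable : {m n : ℕ} → Graph (Fin m) → Graph (Fin n) → Set
CompRealizable {m} {n} G₁ G₂ =
  ∃ λ (o : Orientation m n) → SameGraph (Union G₁ G₂) (Competition (Arc o))

Step12Realizable : {V : Set} → Graph V → Set
Step12Realizable G =
  Σ ℕ λ m → Σ ℕ λ n → 1 ≤ m × 1 ≤ n ×
    Σ (Orientation m n) λ o → Isomorphic G (Step12 (Arc o))

-- C(D) = K_m ⊔ K_n says that any two vertices on one side have a common out-neighbour. Then every
-- pair {y, y′} on the n-side dominates some vertex x (y → x ← y′), whose out-neighbours all
-- avoid the pair, and two vertices dominated by pairs that together cover the n-side would share
-- no out-neighbour. This excludes n ∈ {2, 3, 4}, where two pairs cover, and for n = 5 it forces the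
-- ten pairs to be dominated by ten distinct vertices, as any two pairs and a suitable third cover.
-- Conversely, explicit 6 × 6 and 10 × 5 orientations keep the property when vertices are duplicated.
-- Two vertices on the same side are (1,2)-step competitors only if they compete, since paths of
-- length 2 do not change sides; so a complete C_{1,2}(D) forces C(D) = K_m ⊔ K_n with m, n ≥ 2, and
-- m + n ≥ 12 by (i). The 6 × 6 orientation, widened on one side, has a complete C_{1,2}.
module Submission where

open import Defs
open import Data.Nat using (ℕ; zero; suc; _+_; _∸_; _≤_; z≤n; s≤s; _≤?_)
open import Data.Nat.Properties using (≤-refl; ≤-trans; +-mono-≤; +-comm; ≰⇒≥; m≤m+n; m≤n⇒∃[o]m+o≡n; m+[n∸m]≡n)
open import Data.Fin using (Fin; zero; suc; splitAt; _↑ˡ_; #_)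
open import Data.Fin.Properties using (_≟_; splitAt-↑ˡ; +↔⊎; injective⇒≤; all?; any?)
open import Data.Bool using (true; false; not)
open import Data.Bool.Properties using (not-¬) renaming (_≟_ to _≟ᵇ_)
open import Data.Vec using (Vec; _∷_; []; lookup)
open import Data.Sum using (_⊎_; inj₁; inj₂; [_,_])
open import Data.Sum.Properties using (inj₁-injective; inj₂-injective)
open import Data.Product using (Σ; ∃; _×_; _,_; proj₁; proj₂)
open import Data.Empty using (⊥-elim)
open import Function using (id; const; _∘_)
open import Function.Bundles using (_⇔_; mk⇔; Equivalence; Bijection; _⤖_)
open import Function.Definitions using (StrictlySurjective)
open import Function.Construct.Composition using (_⤖-∘_)
open import Function.Construct.Symmetry using (⤖-sym)
open import Function.Properties.Inverse using (↔⇒⤖)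
open import Relation.Nullary using (¬_; Dec; yes; no)
open import Relation.Nullary.Decidable using (from-yes; ¬?; _×-dec_; _⊎-dec_; _→-dec_; ⌊_⌋)
open import Relation.Binary.PropositionalEquality using (_≡_; _≢_; refl; sym; cong; subst)

private
  variable
    k l m n m′ n′ : ℕ
    V : Set

distinct⇒2≤ : {a b : Fin m} → a ≢ b → 2 ≤ m
distinct⇒2≤ {suc zero} {zero} {zero} a≢b = ⊥-elim (a≢b refl)
distinct⇒2≤ {suc (suc _)} _ = s≤s (s≤s z≤n)

another : 2 ≤ m → (a : Fin m) → ∃ λ b → a ≢ b
another (s≤s (s≤s _)) zero = suc zero , λ ()
another (s≤s (s≤s _)) (suc _) = zero , λ ()

-- Competition graphs of orientations of K_{m,n}

CommonOutˡ : Orientation m n → Fin m → Fin m → Set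
CommonOutˡ o a b = ∃ λ y → o a y ≡ true × o b y ≡ true

CommonOutʳ : Orientation m n → Fin n → Fin n → Set
CommonOutʳ o y y′ = ∃ λ x → o x y ≡ false × o x y′ ≡ false

CompleteCompetition : Orientation m n → Set
CompleteCompetition o =
  (∀ a b → a ≢ b → CommonOutˡ o a b) × (∀ y y′ → y ≢ y′ → CommonOutʳ o y y′)

-- Also for equal vertices: unlike CompleteCompetition, this survives duplicating vertices.
StrongCompleteCompetition : Orientation m n → Set
StrongCompleteCompetition o = (∀ a b → CommonOutˡ o a b) × (∀ y y′ → CommonOutʳ o y y′)

completeCompetition⇔ : (o : Orientation m n) →
  SameGraph (Union (K m) (K n)) (Competition (Arc o)) ⇔ CompleteCompetition o
completeCompetition⇔ {m} {n} o = mk⇔ to from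
  where
  to : SameGraph (Union (K m) (K n)) (Competition (Arc o)) → CompleteCompetition o
  to same = left , right
    where
    left : ∀ a b → a ≢ b → CommonOutˡ o a b
    left a b a≢b with Equivalence.to (same (inj₁ a) (inj₁ b) (a≢b ∘ inj₁-injective)) a≢b
    ... | _ , inj₂ y , p , q = y , p , q
    right : ∀ y y′ → y ≢ y′ → CommonOutʳ o y y′
    right y y′ y≢y′ with Equivalence.to (same (inj₂ y) (inj₂ y′) (y≢y′ ∘ inj₂-injective)) y≢y′
    ... | _ , inj₁ x , p , q = x , p , q
  from : CompleteCompetition o → SameGraph (Union (K m) (K n)) (Competition (Arc o))
  from (left , right) (inj₁ a) (inj₁ b) _ = mk⇔
    (λ a≢b → let y , p , q = left a b a≢b in a≢b ∘ inj₁-injective , inj₂ y , p , q)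
    (λ (u≢v , _) → u≢v ∘ cong inj₁)
  from (left , right) (inj₂ y) (inj₂ y′) _ = mk⇔
    (λ y≢y′ → let x , p , q = right y y′ y≢y′ in y≢y′ ∘ inj₂-injective , inj₁ x , p , q)
    (λ (u≢v , _) → u≢v ∘ cong inj₂)
  from _ (inj₁ _) (inj₂ _) _ = mk⇔ (λ ()) λ { (_ , inj₁ _ , () , _) ; (_ , inj₂ _ , _ , ()) }
  from _ (inj₂ _) (inj₁ _) _ = mk⇔ (λ ()) λ { (_ , inj₁ _ , _ , ()) ; (_ , inj₂ _ , () , _) }

transpose : Orientation m n → Orientation n m
transpose o y x = not (o x y)

completeCompetition-transpose : {o : Orientation m n} →
  CompleteCompetition o → CompleteCompetition (transpose o)
completeCompetition-transpose (left , right) =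
  (λ y y′ y≢y′ → let x , p , q = right y y′ y≢y′ in x , cong not p , cong not q) ,
  (λ a b a≢b → let y , p , q = left a b a≢b in y , cong not p , cong not q)

-- Necessity in (i)

_∈₂_ : Fin n → Fin n × Fin n → Set
y ∈₂ (a , b) = y ≡ a ⊎ y ≡ b

_∈₂?_ : (y : Fin n) (p : Fin n × Fin n) → Dec (y ∈₂ p)
y ∈₂? (a , b) = (y ≟ a) ⊎-dec (y ≟ b)

Distinct : Fin n × Fin n → Set
Distinct (a , b) = a ≢ b

module _ {o : Orientation m n} (2≤m : 2 ≤ m) (competition : CompleteCompetition o) where

  commonOutˡ-all : ∀ a b → CommonOutˡ o a b
  commonOutˡ-all a b with a ≟ b
  ... | no a≢b = proj₁ competition a b a≢b
  ... | yes refl = let c , a≢c = another 2≤m a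
                       y , p , _ = proj₁ competition a c a≢c
                   in y , p , p

  ¬jointlyDominated : (x x′ : Fin m) → ¬ (∀ y → o x y ≡ false ⊎ o x′ y ≡ false)
  ¬jointlyDominated x x′ dominated with commonOutˡ-all x x′
  ... | y , p , q = [ not-¬ p , not-¬ q ] (dominated y)

  dominatedBy : (p : Fin n × Fin n) → Distinct p → ∃ λ x → ∀ y → y ∈₂ p → o x y ≡ false
  dominatedBy (a , b) a≢b with proj₂ competition a b a≢b
  ... | x , xa , xb = x , λ { _ (inj₁ refl) → xa ; _ (inj₂ refl) → xb }

  ¬twoPairsCover : (p q : Fin n × Fin n) → Distinct p → Distinct q →
    ¬ (∀ y → y ∈₂ p ⊎ y ∈₂ q)
  ¬twoPairsCover p q p-distinct q-distinct cover =
    let x , x-dominated = dominatedBy p p-distinct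
        x′ , x′-dominated = dominatedBy q q-distinct
    in ¬jointlyDominated x x′ λ y → [ inj₁ ∘ x-dominated y , inj₂ ∘ x′-dominated y ] (cover y)

  -- The vertex dominated by a pair determines the pair.
  pairsCover⇒≤ : (P : Fin k → Fin n × Fin n) → (∀ i → Distinct (P i)) →
    (∀ i j → i ≢ j → ∃ λ r → ∀ y → y ∈₂ P i ⊎ y ∈₂ P j ⊎ y ∈₂ P r) → k ≤ m
  pairsCover⇒≤ {k} P distinct cover = injective⇒≤ {f = X} X-injective
    where
    X : Fin k → Fin m
    X i = proj₁ (dominatedBy (P i) (distinct i))
    X-dominated : ∀ i y → y ∈₂ P i → o (X i) y ≡ false
    X-dominated i = proj₂ (dominatedBy (P i) (distinct i))
    X-injective : ∀ {i j} → X i ≡ X j → i ≡ j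
    X-injective {i} {j} Xi≡Xj with i ≟ j
    ... | yes i≡j = i≡j
    ... | no i≢j = ⊥-elim (¬jointlyDominated (X i) (X r) dominated)
      where
      r : Fin k
      r = proj₁ (cover i j i≢j)
      dominated : ∀ y → o (X i) y ≡ false ⊎ o (X r) y ≡ false
      dominated y with proj₂ (cover i j i≢j) y
      ... | inj₁ y∈Pi = inj₁ (X-dominated i y y∈Pi)
      ... | inj₂ (inj₁ y∈Pj) = inj₁ (subst (λ x → o x y ≡ false) (sym Xi≡Xj) (X-dominated j y y∈Pj))
      ... | inj₂ (inj₂ y∈Pr) = inj₂ (X-dominated r y y∈Pr)

pair₅ : Fin 10 → Fin 5 × Fin 5
pair₅ = lookup ((# 0 , # 1) ∷ (# 0 , # 2) ∷ (# 0 , # 3) ∷ (# 0 , # 4) ∷ (# 1 , # 2) ∷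
                (# 1 , # 3) ∷ (# 1 , # 4) ∷ (# 2 , # 3) ∷ (# 2 , # 4) ∷ (# 3 , # 4) ∷ [])

pair₅-distinct : ∀ i → Distinct (pair₅ i)
pair₅-distinct = from-yes (all? λ i → ¬? (proj₁ (pair₅ i) ≟ proj₂ (pair₅ i)))

pair₅-cover : ∀ i j → i ≢ j → ∃ λ r → ∀ y → y ∈₂ pair₅ i ⊎ y ∈₂ pair₅ j ⊎ y ∈₂ pair₅ r
pair₅-cover = from-yes (all? λ i → all? λ j → ¬? (i ≟ j) →-dec
  any? λ r → all? λ y → y ∈₂? pair₅ i ⊎-dec y ∈₂? pair₅ j ⊎-dec y ∈₂? pair₅ r)

Admissible : ℕ → ℕ → Set
Admissible m n = n ≡ 1 ⊎ ((n ≤ m × 6 ≤ n) ⊎ (10 ≤ m × n ≡ 5))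

necessity : {o : Orientation m n} → CompleteCompetition o → 1 ≤ n → n ≤ m → Admissible m n
necessity {n = 1} _ _ _ = inj₁ refl
necessity {n = 2} c _ 2≤m =
  ⊥-elim (¬twoPairsCover 2≤m c (# 0 , # 1) (# 0 , # 1) (λ ()) (λ ())
    (from-yes (all? {n = 2} λ y → y ∈₂? (# 0 , # 1) ⊎-dec y ∈₂? (# 0 , # 1))))
necessity {n = 3} c _ 3≤m =
  ⊥-elim (¬twoPairsCover (≤-trans (s≤s (s≤s z≤n)) 3≤m) c (# 0 , # 1) (# 1 , # 2) (λ ()) (λ ())
    (from-yes (all? {n = 3} λ y → y ∈₂? (# 0 , # 1) ⊎-dec y ∈₂? (# 1 , # 2))))
necessity {n = 4} c _ 4≤m =
  ⊥-elim (¬twoPairsCover (≤-trans (s≤s (s≤s z≤n)) 4≤m) c (# 0 , # 1) (# 2 , # 3) (λ ()) (λ ())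
    (from-yes (all? {n = 4} λ y → y ∈₂? (# 0 , # 1) ⊎-dec y ∈₂? (# 2 , # 3))))
necessity {n = 5} c _ 5≤m =
  inj₂ (inj₂ (pairsCover⇒≤ (≤-trans (s≤s (s≤s z≤n)) 5≤m) c pair₅ pair₅-distinct pair₅-cover , refl))
necessity {n = suc (suc (suc (suc (suc (suc k)))))} _ _ n≤m = inj₂ (inj₁ (n≤m , m≤m+n 6 k))

-- Sufficiency in (i)

pullback : Orientation m n → (Fin m′ → Fin m) → (Fin n′ → Fin n) → Orientation m′ n′
pullback o f g x y = o (f x) (g y)

module _ {o : Orientation m n} {f : Fin m′ → Fin m} {g : Fin n′ → Fin n}
         (f-surjective : StrictlySurjective _≡_ f) (g-surjective : StrictlySurjective _≡_ g) where

  strongCompleteCompetition-pullback :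
    StrongCompleteCompetition o → StrongCompleteCompetition (pullback o f g)
  strongCompleteCompetition-pullback (left , right) = left′ , right′
    where
    left′ : ∀ a b → CommonOutˡ (pullback o f g) a b
    left′ a b with left (f a) (f b)
    ... | y , p , q with g-surjective y
    ...   | y′ , refl = y′ , p , q
    right′ : ∀ y y′ → CommonOutʳ (pullback o f g) y y′
    right′ y y′ with right (g y) (g y′)
    ... | x , p , q with f-surjective x
    ...   | x′ , refl = x′ , p , q

strong⇒complete : {o : Orientation m n} → StrongCompleteCompetition o → CompleteCompetition o
strong⇒complete (left , right) = (λ a b _ → left a b) , (λ y y′ _ → right y y′)

strongCompleteCompetition? : (o : Orientation m n) → Dec (StrongCompleteCompetition o)
strongCompleteCompetition? o =
  (all? λ a → all? λ b → any? λ y → (o a y ≟ᵇ true) ×-dec (o b y ≟ᵇ true)) ×-dec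
  (all? λ y → all? λ y′ → any? λ x → (o x y ≟ᵇ false) ×-dec (o x y′ ≟ᵇ false))

squash : Fin m → Fin (m + k) → Fin m
squash {m} x₀ = [ id , const x₀ ] ∘ splitAt m

squash-surjective : (x₀ : Fin m) → StrictlySurjective _≡_ (squash {k = k} x₀)
squash-surjective {m} {k} x₀ x = x ↑ˡ k , cong [ id , const x₀ ] (splitAt-↑ˡ m x k)

compRealizable-from-core : {r c : ℕ} (o : Orientation (suc r) (suc c)) → StrongCompleteCompetition o →
  suc r ≤ m → suc c ≤ n → CompRealizable (K m) (K n)
compRealizable-from-core o strong r<m c<n with m≤n⇒∃[o]m+o≡n r<m | m≤n⇒∃[o]m+o≡n c<n
... | _ , refl | _ , refl =
  pullback o (squash zero) (squash zero) ,
  Equivalence.from (completeCompetition⇔ _)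
    (strong⇒complete (strongCompleteCompetition-pullback
      (squash-surjective zero) (squash-surjective zero) strong))

core₆ : Orientation 6 6
core₆ a y = ⌊ y ∈₃? lookup triples a ⌋
  where
  triples : Vec (Fin 6 × Fin 6 × Fin 6) 6
  triples = (# 0 , # 1 , # 2) ∷ (# 0 , # 1 , # 3) ∷ (# 0 , # 4 , # 5) ∷
            (# 1 , # 4 , # 5) ∷ (# 2 , # 3 , # 4) ∷ (# 2 , # 3 , # 5) ∷ []
  _∈₃?_ : (y : Fin 6) ((a , b , c) : Fin 6 × Fin 6 × Fin 6) → Dec (y ≡ a ⊎ y ≡ b ⊎ y ≡ c)
  y ∈₃? (a , b , c) = (y ≟ a) ⊎-dec (y ≟ b) ⊎-dec (y ≟ c)

-- The out-neighbourhoods are the complements of the pairs, i.e. the ten 3-subsets of Fin 5.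
core₅ : Orientation 10 5
core₅ i y = not ⌊ y ∈₂? pair₅ i ⌋

core₆-strong : StrongCompleteCompetition core₆
core₆-strong = from-yes (strongCompleteCompetition? core₆)

core₅-strong : StrongCompleteCompetition core₅
core₅-strong = from-yes (strongCompleteCompetition? core₅)

sufficiency : n ≤ m → Admissible m n → CompRealizable (K m) (K n)
sufficiency _ (inj₁ refl) =
  (λ _ _ → true) ,
  Equivalence.from (completeCompetition⇔ _)
    ((λ _ _ _ → zero , refl , refl) , λ { zero zero 0≢0 → ⊥-elim (0≢0 refl) ; (suc ()) _ _ ; _ (suc ()) _ })
sufficiency n≤m (inj₂ (inj₁ (_ , 6≤n))) = compRealizable-from-core core₆ core₆-strong (≤-trans 6≤n n≤m) 6≤n
sufficiency _ (inj₂ (inj₂ (10≤m , refl))) = compRealizable-from-core core₅ core₅-strong 10≤m ≤-refl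

-- (1,2)-step competition graphs of orientations of K_{m,n}

module _ {D : Digraph V} {z : V} where

  distLe1⇒arc : ∀ {x y} → DistLe D z x y 1 → x ≢ y → D x y
  distLe1⇒arc (0 , _ , here _) x≢x = ⊥-elim (x≢x refl)
  distLe1⇒arc (1 , _ , step _ xy (here _)) _ = xy
  distLe1⇒arc (suc (suc _) , s≤s () , _) _

  distLe2⇒path : ∀ {x y} → DistLe D z x y 2 → x ≢ y →
    D x y ⊎ ∃ λ t → t ≢ z × D x t × D t y
  distLe2⇒path (0 , _ , here _) x≢x = ⊥-elim (x≢x refl)
  distLe2⇒path (1 , _ , step _ xy (here _)) _ = inj₁ xy
  distLe2⇒path (2 , _ , step _ xt (step t≢z ty (here _))) _ = inj₂ (_ , t≢z , xt , ty)
  distLe2⇒path (suc (suc (suc _)) , s≤s (s≤s ()) , _) _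

step12-sym : {D : Digraph V} {u v : V} → Step12 D u v → Step12 D v u
step12-sym (u≢v , w , w≢u , w≢v , inj₁ paths) = u≢v ∘ sym , w , w≢v , w≢u , inj₂ paths
step12-sym (u≢v , w , w≢u , w≢v , inj₂ paths) = u≢v ∘ sym , w , w≢v , w≢u , inj₁ paths

-- Meeting at w on the right: a → w and b → z → w; on the left: b → w and a → z → w.
MeetRight MeetLeft Meet : Orientation m n → Fin m → Fin n → Set
MeetRight {m} {n} o a b = Σ (Fin n) λ w → Σ (Fin m) λ z →
  w ≢ b × z ≢ a × o a w ≡ true × o z b ≡ false × o z w ≡ true
MeetLeft {m} {n} o a b = Σ (Fin m) λ w → Σ (Fin n) λ z →
  w ≢ a × z ≢ b × o w b ≡ false × o a z ≡ true × o w z ≡ false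
Meet o a b = MeetRight o a b ⊎ MeetLeft o a b

module _ {o : Orientation m n} where

  step12⇒commonOutˡ : ∀ {a b} → Step12 (Arc o) (inj₁ a) (inj₁ b) → CommonOutˡ o a b
  step12⇒commonOutˡ (_ , inj₂ y , y≢a , y≢b , inj₁ (p , q)) with distLe2⇒path q (y≢b ∘ sym)
  ... | inj₁ by = y , distLe1⇒arc p (y≢a ∘ sym) , by
  ... | inj₂ (inj₁ _ , _ , () , _)
  ... | inj₂ (inj₂ _ , _ , _ , ())
  step12⇒commonOutˡ (_ , inj₂ y , y≢a , y≢b , inj₂ (p , q)) with distLe2⇒path q (y≢a ∘ sym)
  ... | inj₁ ay = y , ay , distLe1⇒arc p (y≢b ∘ sym)
  ... | inj₂ (inj₁ _ , _ , () , _)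
  ... | inj₂ (inj₂ _ , _ , _ , ())
  step12⇒commonOutˡ (_ , inj₁ _ , c≢a , _ , inj₁ (p , _)) = ⊥-elim (distLe1⇒arc p (c≢a ∘ sym))
  step12⇒commonOutˡ (_ , inj₁ _ , _ , c≢b , inj₂ (p , _)) = ⊥-elim (distLe1⇒arc p (c≢b ∘ sym))

  step12⇒commonOutʳ : ∀ {y y′} → Step12 (Arc o) (inj₂ y) (inj₂ y′) → CommonOutʳ o y y′
  step12⇒commonOutʳ (_ , inj₁ x , x≢y , x≢y′ , inj₁ (p , q)) with distLe2⇒path q (x≢y′ ∘ sym)
  ... | inj₁ y′x = x , distLe1⇒arc p (x≢y ∘ sym) , y′x
  ... | inj₂ (inj₁ _ , _ , _ , ())
  ... | inj₂ (inj₂ _ , _ , () , _)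
  step12⇒commonOutʳ (_ , inj₁ x , x≢y , x≢y′ , inj₂ (p , q)) with distLe2⇒path q (x≢y ∘ sym)
  ... | inj₁ yx = x , yx , distLe1⇒arc p (x≢y′ ∘ sym)
  ... | inj₂ (inj₁ _ , _ , _ , ())
  ... | inj₂ (inj₂ _ , _ , () , _)
  step12⇒commonOutʳ (_ , inj₂ _ , c≢y , _ , inj₁ (p , _)) = ⊥-elim (distLe1⇒arc p (c≢y ∘ sym))
  step12⇒commonOutʳ (_ , inj₂ _ , _ , c≢y′ , inj₂ (p , _)) = ⊥-elim (distLe1⇒arc p (c≢y′ ∘ sym))

  step12⇒meet : ∀ {a b} → Step12 (Arc o) (inj₁ a) (inj₂ b) → Meet o a b
  step12⇒meet (_ , inj₂ w , w≢a , w≢b , inj₁ (p , q)) with distLe2⇒path q (w≢b ∘ sym)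
  ... | inj₂ (inj₁ z , z≢a , bz , zw) =
        inj₁ (w , z , w≢b ∘ cong inj₂ , z≢a ∘ cong inj₁ , distLe1⇒arc p (w≢a ∘ sym) , bz , zw)
  ... | inj₂ (inj₂ _ , _ , () , _)
  step12⇒meet (_ , inj₁ w , w≢a , w≢b , inj₂ (p , q)) with distLe2⇒path q (w≢a ∘ sym)
  ... | inj₂ (inj₂ z , z≢b , az , zw) =
        inj₂ (w , z , w≢a ∘ cong inj₁ , z≢b ∘ cong inj₂ , distLe1⇒arc p (w≢b ∘ sym) , az , zw)
  ... | inj₂ (inj₁ _ , _ , () , _)
  step12⇒meet (_ , inj₁ _ , w≢a , _ , inj₁ (p , _)) = ⊥-elim (distLe1⇒arc p (w≢a ∘ sym))
  step12⇒meet (_ , inj₂ _ , _ , w≢b , inj₂ (p , _)) = ⊥-elim (distLe1⇒arc p (w≢b ∘ sym))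

  commonOutˡ⇒step12 : ∀ {a b} → a ≢ b → CommonOutˡ o a b → Step12 (Arc o) (inj₁ a) (inj₁ b)
  commonOutˡ⇒step12 a≢b (y , ay , by) =
    a≢b ∘ inj₁-injective , inj₂ y , (λ ()) , (λ ()) ,
    inj₁ ((1 , s≤s z≤n , step (a≢b ∘ inj₁-injective) ay (here λ ())) ,
          (1 , s≤s z≤n , step (a≢b ∘ sym ∘ inj₁-injective) by (here λ ())))

  commonOutʳ⇒step12 : ∀ {y y′} → y ≢ y′ → CommonOutʳ o y y′ → Step12 (Arc o) (inj₂ y) (inj₂ y′)
  commonOutʳ⇒step12 y≢y′ (x , yx , y′x) =
    y≢y′ ∘ inj₂-injective , inj₁ x , (λ ()) , (λ ()) ,
    inj₁ ((1 , s≤s z≤n , step (y≢y′ ∘ inj₂-injective) yx (here λ ())) ,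
          (1 , s≤s z≤n , step (y≢y′ ∘ sym ∘ inj₂-injective) y′x (here λ ())))

  meet⇒step12 : ∀ {a b} → Meet o a b → Step12 (Arc o) (inj₁ a) (inj₂ b)
  meet⇒step12 (inj₁ (w , z , w≢b , z≢a , aw , bz , zw)) =
    (λ ()) , inj₂ w , (λ ()) , w≢b ∘ inj₂-injective ,
    inj₁ ((1 , s≤s z≤n , step (λ ()) aw (here (w≢b ∘ inj₂-injective))) ,
          (2 , ≤-refl , step (λ ()) bz (step (z≢a ∘ inj₁-injective) zw (here λ ()))))
  meet⇒step12 (inj₂ (w , z , w≢a , z≢b , bw , az , zw)) =
    (λ ()) , inj₁ w , w≢a ∘ inj₁-injective , (λ ()) ,
    inj₂ ((1 , s≤s z≤n , step (λ ()) bw (here (w≢a ∘ inj₁-injective))) ,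
          (2 , ≤-refl , step (λ ()) az (step (z≢b ∘ inj₂-injective) zw (here λ ()))))

  meet⇒2≤ : ∀ {a b} → Meet o a b → 2 ≤ m × 2 ≤ n
  meet⇒2≤ (inj₁ (_ , _ , w≢b , z≢a , _)) = distinct⇒2≤ z≢a , distinct⇒2≤ w≢b
  meet⇒2≤ (inj₂ (_ , _ , w≢a , z≢b , _)) = distinct⇒2≤ w≢a , distinct⇒2≤ z≢b

meet? : (o : Orientation m n) (a : Fin m) (b : Fin n) → Dec (Meet o a b)
meet? o a b =
  (any? λ w → any? λ z → ¬? (w ≟ b) ×-dec ¬? (z ≟ a) ×-dec
     (o a w ≟ᵇ true) ×-dec (o z b ≟ᵇ false) ×-dec (o z w ≟ᵇ true)) ⊎-dec
  (any? λ w → any? λ z → ¬? (w ≟ a) ×-dec ¬? (z ≟ b) ×-dec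
     (o w b ≟ᵇ false) ×-dec (o a z ≟ᵇ true) ×-dec (o w z ≟ᵇ false))

meet-pullback : {o : Orientation m n} {f : Fin m′ → Fin m} {g : Fin n′ → Fin n} →
  StrictlySurjective _≡_ f → StrictlySurjective _≡_ g →
  ∀ {a b} → Meet o (f a) (g b) → Meet (pullback o f g) a b
meet-pullback {f = f} {g} f-surjective g-surjective (inj₁ (w , z , w≢gb , z≢fa , aw , bz , zw))
  with g-surjective w | f-surjective z
... | w′ , refl | z′ , refl = inj₁ (w′ , z′ , w≢gb ∘ cong g , z≢fa ∘ cong f , aw , bz , zw)
meet-pullback {f = f} {g} f-surjective g-surjective (inj₂ (w , z , w≢fa , z≢gb , bw , az , zw))
  with f-surjective w | g-surjective z
... | w′ , refl | z′ , refl = inj₂ (w′ , z′ , w≢fa ∘ cong f , z≢gb ∘ cong g , bw , az , zw)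

Step12Complete : Orientation m n → Set
Step12Complete o = ∀ u v → u ≢ v → Step12 (Arc o) u v

step12Complete⇒completeCompetition : {o : Orientation m n} →
  Step12Complete o → CompleteCompetition o
step12Complete⇒completeCompetition complete =
  (λ a b a≢b → step12⇒commonOutˡ (complete (inj₁ a) (inj₁ b) (a≢b ∘ inj₁-injective))) ,
  (λ y y′ y≢y′ → step12⇒commonOutʳ (complete (inj₂ y) (inj₂ y′) (y≢y′ ∘ inj₂-injective)))

step12Complete⇒2≤ : {o : Orientation m n} → 1 ≤ m → 1 ≤ n → Step12Complete o → 2 ≤ m × 2 ≤ n
step12Complete⇒2≤ {suc _} {suc _} _ _ complete =
  meet⇒2≤ (step12⇒meet (complete (inj₁ zero) (inj₂ zero) λ ()))

strong-meet⇒step12Complete : {o : Orientation m n} →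
  StrongCompleteCompetition o → (∀ a b → Meet o a b) → Step12Complete o
strong-meet⇒step12Complete (left , _) _ (inj₁ a) (inj₁ b) a≢b =
  commonOutˡ⇒step12 (a≢b ∘ cong inj₁) (left a b)
strong-meet⇒step12Complete (_ , right) _ (inj₂ y) (inj₂ y′) y≢y′ =
  commonOutʳ⇒step12 (y≢y′ ∘ cong inj₂) (right y y′)
strong-meet⇒step12Complete _ meet (inj₁ a) (inj₂ b) _ = meet⇒step12 (meet a b)
strong-meet⇒step12Complete _ meet (inj₂ b) (inj₁ a) _ = step12-sym (meet⇒step12 (meet a b))

isomorphic-K⇒complete : {G : Graph V} → Isomorphic (K l) G → ∀ u v → u ≢ v → G u v
isomorphic-K⇒complete (f , adjacent) u v u≢v
  with Bijection.strictlySurjective f u | Bijection.strictlySurjective f v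
... | x , refl | y , refl = Equivalence.to (adjacent x y x≢y) x≢y
  where
  x≢y : x ≢ y
  x≢y = u≢v ∘ cong (Bijection.to f)

complete⇒isomorphic-K : {G : Graph V} → Fin l ⤖ V → (∀ u v → u ≢ v → G u v) → Isomorphic (K l) G
complete⇒isomorphic-K f complete =
  f , λ x y x≢y → mk⇔ (λ _ → complete _ _ (x≢y ∘ Bijection.injective f)) (λ _ → x≢y)

⤖⇒+≤ : Fin l ⤖ (Fin m ⊎ Fin n) → m + n ≤ l
⤖⇒+≤ {m = m} f = injective⇒≤ (Bijection.injective (⤖-sym f ⤖-∘ ↔⇒⤖ (+↔⊎ {m})))

admissible⇒12≤ : 2 ≤ n → Admissible m n → 12 ≤ m + n
admissible⇒12≤ (s≤s ()) (inj₁ refl)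
admissible⇒12≤ _ (inj₂ (inj₁ (n≤m , 6≤n))) = +-mono-≤ (≤-trans 6≤n n≤m) 6≤n
admissible⇒12≤ 2≤n (inj₂ (inj₂ (10≤m , _))) = +-mono-≤ 10≤m 2≤n

completeCompetition⇒12≤ : {o : Orientation m n} → CompleteCompetition o → 2 ≤ m → 2 ≤ n → 12 ≤ m + n
completeCompetition⇒12≤ {m} {n} competition 2≤m 2≤n with n ≤? m
... | yes n≤m = admissible⇒12≤ 2≤n (necessity competition (≤-trans (s≤s z≤n) 2≤n) n≤m)
... | no n≰m = subst (12 ≤_) (+-comm n m)
      (admissible⇒12≤ 2≤m (necessity (completeCompetition-transpose competition)
                                      (≤-trans (s≤s z≤n) 2≤m) (≰⇒≥ n≰m)))

step12Realizable⇒12≤ : Step12Realizable (K l) → 12 ≤ l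
step12Realizable⇒12≤ (m , n , 1≤m , 1≤n , o , iso) =
  let complete : Step12Complete o
      complete = isomorphic-K⇒complete iso
      2≤m , 2≤n = step12Complete⇒2≤ 1≤m 1≤n complete
  in ≤-trans (completeCompetition⇒12≤ (step12Complete⇒completeCompetition complete) 2≤m 2≤n)
             (⤖⇒+≤ (proj₁ iso))

core₆-meet : ∀ a b → Meet core₆ a b
core₆-meet = from-yes (all? λ a → all? λ b → meet? core₆ a b)

id-surjective : StrictlySurjective _≡_ (id {A = V})
id-surjective x = x , refl

step12Realizable-K12+ : (k : ℕ) → Step12Realizable (K (6 + (6 + k)))
step12Realizable-K12+ k =
  6 , 6 + k , s≤s z≤n , s≤s z≤n , o ,
  complete⇒isomorphic-K (↔⇒⤖ (+↔⊎ {6} {6 + k}))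
    (strong-meet⇒step12Complete
      (strongCompleteCompetition-pullback id-surjective (squash-surjective zero) core₆-strong)
      (λ a b → meet-pullback id-surjective (squash-surjective zero) (core₆-meet a (squash zero b))))
  where
  o : Orientation 6 (6 + k)
  o = pullback core₆ id (squash zero)

12≤⇒step12Realizable : 12 ≤ l → Step12Realizable (K l)
12≤⇒step12Realizable {l} 12≤l =
  subst (Step12Realizable ∘ K) (m+[n∸m]≡n 12≤l) (step12Realizable-K12+ (l ∸ 12))

theorem3p5 : ((m n : ℕ) → 1 ≤ n → n ≤ m →
    (CompRealizable (K m) (K n) ⇔
    (n ≡ 1 ⊎ ((n ≤ m × 6 ≤ n) ⊎ (10 ≤ m × n ≡ 5)))))
    ×
    ((l : ℕ) → 1 ≤ l → (Step12Realizable (K l) ⇔ 12 ≤ l))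
theorem3p5 =
  (λ m n 1≤n n≤m → mk⇔
    (λ (o , same) → necessity (Equivalence.to (completeCompetition⇔ o) same) 1≤n n≤m)
    (sufficiency n≤m)) ,
  (λ l _ → mk⇔ step12Realizable⇒12≤ 12≤⇒step12Realizable)
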